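{- Let $d\ge3$, $h\ge1$. The sandpile group $G(d,h)$ contains a subgroup isomorphic to $(\mathbb{Z}/d\mathbb{Z})^{(d-1)^h}$ (the direct sum of $(d-1)^h$ copies of $\mathbb{Z}_d$).
   Context: Let $\mathcal{T}(d,h)$ be the ball of radius $h$ about a root vertex $0$ in the infinite $d$-regular tree (root has $d$ children, vertices at depth $1,\dots,h-1$ have $d-1$ children, depth-$h$ vertices are leaves). Let $V$ be its vertex set, $p(i)$ the parent of $i\neq 0$, $C_i$ the children of $i$, $\{\mathbf{x}_i\}$ the standard basis of $\mathbb{Z}^V$, and $\delta_i = d\mathbf{x}_i - \mathbf{x}_{p(i)} - \sum_{j\in C_i}\mathbf{x}_j$ (omit $\mathbf{x}_{p(i)}$ for $i=0$; empty sum for leaves). The sandpile group is $G(d,h)=\mathbb{Z}^V/\sum_{i\in V}\mathbb{Z}\delta_i$. -}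

module Defs where

open import Data.Nat as ℕ using (ℕ; zero; suc; _∸_; _^_)
open import Data.Integer as ℤ using (ℤ; +_; _+_; _-_; _*_)
open import Data.Fin using (Fin)
open import Data.Fin.Properties using () renaming (_≟_ to _≟F_)
open import Data.List using (List; []; _∷_; map; concatMap; foldr)
open import Data.List.Base using (allFin)
open import Data.Maybe using (Maybe; just; nothing)
open import Data.Product using (Σ; ∃; _×_; _,_)
open import Relation.Binary.PropositionalEquality using (_≡_; refl; cong; cong₂)
open import Relation.Nullary using (Dec; yes; no; ¬_)

-- Vertices of the complete m-ary rooted tree of height h:
--   top        = its root,
--   below a t  = the vertex t of the subtree hanging from the a-th child.
data Sub (m : ℕ) : ℕ → Set where
  top   : ∀ {h} → Sub m h
  below : ∀ {h} → Fin m → Sub m h → Sub m (suc h)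

-- Vertices of T(d,h): the root 0, and (for h ≥ 1) for each of the d
-- children a of the root, the vertices of the complete (d-1)-ary tree of
-- height h-1 rooted at a.
data Vtx (d : ℕ) : ℕ → Set where
  root : ∀ {h} → Vtx d h
  br   : ∀ {h} → Fin d → Sub (d ∸ 1) h → Vtx d (suc h)

allSub : (m h : ℕ) → List (Sub m h)
allSub m zero    = top ∷ []
allSub m (suc h) = top ∷ concatMap (λ a → map (below a) (allSub m h)) (allFin m)

allVtx : (d h : ℕ) → List (Vtx d h)
allVtx d zero    = root ∷ []
allVtx d (suc h) = root ∷ concatMap (λ a → map (br a) (allSub (d ∸ 1) h)) (allFin d)

parentSub : ∀ {m h} → Sub m h → Maybe (Sub m h)
parentSub top                 = nothing
parentSub (below a top)       = just top
parentSub (below a (below b t)) with parentSub (below b t)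
... | nothing = nothing
... | just s  = just (below a s)

parent : ∀ {d h} → Vtx d h → Maybe (Vtx d h)
parent root = nothing
parent (br a t) with parentSub t
... | nothing = just root
... | just s  = just (br a s)

below-inj : ∀ {m h} {a b : Fin m} {s t : Sub m h} → below a s ≡ below b t → (a ≡ b) × (s ≡ t)
below-inj refl = refl , refl

_≟S_ : ∀ {m h} (s t : Sub m h) → Dec (s ≡ t)
top ≟S top = yes refl
top ≟S below _ _ = no λ ()
below _ _ ≟S top = no λ ()
below a s ≟S below b t with a ≟F b | s ≟S t
... | yes refl | yes refl = yes refl
... | no a≢b | _ = no λ e → a≢b (Data.Product.proj₁ (below-inj e))
... | yes _ | no s≢t = no λ e → s≢t (Data.Product.proj₂ (below-inj e))

br-inj : ∀ {d h} {a b : Fin d} {s t : Sub (d ∸ 1) h} → br {d} a s ≡ br b t → (a ≡ b) × (s ≡ t)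
br-inj refl = refl , refl

_≟V_ : ∀ {d h} (u v : Vtx d h) → Dec (u ≡ v)
root ≟V root = yes refl
root ≟V br _ _ = no λ ()
br _ _ ≟V root = no λ ()
br a s ≟V br b t with a ≟F b | s ≟S t
... | yes refl | yes refl = yes refl
... | no a≢b | _ = no λ e → a≢b (Data.Product.proj₁ (br-inj e))
... | yes _ | no s≢t = no λ e → s≢t (Data.Product.proj₂ (br-inj e))

[_≡?_] : ∀ {d h} → Vtx d h → Vtx d h → ℤ
[ u ≡? v ] with u ≟V v
... | yes _ = + 1
... | no _  = + 0

[_≡?just_] : ∀ {d h} → Maybe (Vtx d h) → Vtx d h → ℤ
[ nothing ≡?just v ] = + 0
[ just u  ≡?just v ] = [ u ≡? v ]

-- δ_i = d x_i - x_{p(i)} - Σ_{j ∈ C_i} x_j, as a function V → ℤ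
-- (x_{p(i)} omitted for the root; j ∈ C_i iff p(j) = i).
δ : (d h : ℕ) → Vtx d h → Vtx d h → ℤ
δ d h i v = (+ d) * [ i ≡? v ] - [ parent i ≡?just v ] - [ parent v ≡?just i ]

sumℤ : List ℤ → ℤ
sumℤ = foldr _+_ (+ 0)

InSpan : (d h : ℕ) → (Vtx d h → ℤ) → Set
InSpan d h x = Σ (Vtx d h → ℤ) λ c →
  ∀ v → x v ≡ sumℤ (map (λ i → c i * δ d h i v) (allVtx d h))

-- Equality in the sandpile group G(d,h) = ℤ^V / Σ_i ℤ δ_i.
EqG : (d h : ℕ) → (Vtx d h → ℤ) → (Vtx d h → ℤ) → Set
EqG d h x y = InSpan d h (λ v → x v - y v)

_+V_ : ∀ {A : Set} → (A → ℤ) → (A → ℤ) → (A → ℤ)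
(x +V y) a = x a + y a

-- (ℤ/dℤ)^N represented as ℤ^(Fin N) modulo d.
_≡[mod_]_ : ℤ → ℕ → ℤ → Set
a ≡[mod d ] b = ∃ λ q → a - b ≡ q * (+ d)

EqZd : (d N : ℕ) → (Fin N → ℤ) → (Fin N → ℤ) → Set
EqZd d N a b = ∀ k → a k ≡[mod d ] b k

-- An injective group homomorphism (ℤ/dℤ)^N → G(d,h), i.e. an isomorphism
-- of (ℤ/dℤ)^N onto a subgroup of G(d,h) (its image).
record ZdEmbedding (N d h : ℕ) : Set where
  field
    f    : (Fin N → ℤ) → (Vtx d h → ℤ)
    wd   : ∀ a b → EqZd d N a b → EqG d h (f a) (f b)
    hom  : ∀ a b → EqG d h (f (a +V b)) (f a +V f b)
    inj  : ∀ a b → EqG d h (f a) (f b) → EqZd d N a b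

-- Write Δ c = Σᵢ cᵢ δᵢ, so Δ c = d·c − A c with A the adjacency operator, and m = d − 1.
-- Δ is injective over ℤ: if Δ z = 0 then d·z(v) is the sum of z over the neighbours of v;
-- solving this from the leaves upwards, z is t times 1, 1 + m, 1 + m + m², … along every
-- branch, and the equation at the root forces t = 0.
-- The kernel of A contains the vectors vanishing off the levels of the parity of the leaves
-- whose values around each off-level vertex sum to zero.  Letting child 0 of every off-level
-- vertex absorb the balance, these are parametrised linearly by their values at the remaining
-- (d − 1)ʰ on-level vertices.  Such x satisfy Δ x = d·x, so x ↦ [x] is a homomorphism from
-- (ℤ/d)^((d−1)ʰ) to G(d,h); it is injective, since x − y = Δ c gives Δ (x − y − d·c) = 0,
-- hence x − y = d·c.

module Submission where

open import Defs
open import Data.Nat as ℕ using (ℕ; zero; suc; _≤_; s≤s; _∸_; _^_)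
open import Data.Integer using (ℤ; +_; _+_; _-_; _*_; -_; 0ℤ; 1ℤ; -1ℤ)
import Data.Nat.Properties as ℕₚ
import Data.Integer.Properties as ℤ
open import Data.Integer.Tactic.RingSolver using (solve-∀)
open import Data.Fin using (Fin; zero; suc)
open import Data.Fin.Properties using (suc-injective)
open import Data.List using (List; []; _∷_; map; _++_; concat; concatMap)
open import Data.List.Base using (allFin; tabulate)
open import Data.Product using (_×_; _,_; proj₁; proj₂)
open import Data.Sum using (_⊎_; inj₁; inj₂)
import Data.Vec.Recursive as Tuple
open import Data.Bool using (Bool; true; false; not)
open import Data.Maybe using (Maybe; just; nothing)
open import Data.Empty using (⊥-elim)
open import Relation.Nullary using (Dec; yes; no)
open import Relation.Binary.PropositionalEquality
open import Function using (_∘_; Inverse)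
open import Algebra.Properties.Semiring.Sum ℤ.+-*-semiring
  using (sum; sum-cong-≋; ∑-distrib-+; *-distribˡ-sum; sum-replicate-zero)

pos-suc-* : ∀ a b → + suc (a ℕ.* b) ≡ 1ℤ + + a * + b
pos-suc-* a b = trans (ℤ.pos-+ 1 (a ℕ.* b)) (cong (_+_ 1ℤ) (ℤ.pos-* a b))

a≡b+c⇒b≡a-c : ∀ {a b c : ℤ} → a ≡ b + c → b ≡ a - c
a≡b+c⇒b≡a-c {a} {b} {c} refl = cancel b c
  where
  cancel : ∀ (b c : ℤ) → b ≡ b + c - c
  cancel = solve-∀

LinComb : {A : Set} → ℤ → ℤ → (A → ℤ) → (A → ℤ) → (A → ℤ) → Set
LinComb x y f g₁ g₂ = ∀ a → f a ≡ x * g₁ a + y * g₂ a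

zero-lincomb : ∀ (x y : ℤ) → 0ℤ ≡ x * 0ℤ + y * 0ℤ
zero-lincomb = solve-∀

sumOver : {A : Set} → List A → (A → ℤ) → ℤ
sumOver xs f = sumℤ (map f xs)

module _ {A : Set} where

  sumOver-cong : ∀ (xs : List A) {f g : A → ℤ} → (∀ x → f x ≡ g x) → sumOver xs f ≡ sumOver xs g
  sumOver-cong []       e = refl
  sumOver-cong (x ∷ xs) e = cong₂ _+_ (e x) (sumOver-cong xs e)

  sumOver-zero : ∀ (xs : List A) {f : A → ℤ} → (∀ x → f x ≡ 0ℤ) → sumOver xs f ≡ 0ℤ
  sumOver-zero []       e = refl
  sumOver-zero (x ∷ xs) e = cong₂ _+_ (e x) (sumOver-zero xs e)

  sumOver-+ : ∀ (xs : List A) (f g : A → ℤ) →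
              sumOver xs (λ x → f x + g x) ≡ sumOver xs f + sumOver xs g
  sumOver-+ []       f g = refl
  sumOver-+ (x ∷ xs) f g = begin
    f x + g x + sumOver xs (λ x → f x + g x)   ≡⟨ cong (_+_ (f x + g x)) (sumOver-+ xs f g) ⟩
    f x + g x + (sumOver xs f + sumOver xs g)  ≡⟨ middle-swap (f x) (g x) _ _ ⟩
    f x + sumOver xs f + (g x + sumOver xs g)  ∎
    where
    open ≡-Reasoning
    middle-swap : ∀ (a b c e : ℤ) → a + b + (c + e) ≡ a + c + (b + e)
    middle-swap = solve-∀

  sumOver-* : ∀ (xs : List A) (c : ℤ) (f : A → ℤ) → sumOver xs (λ x → c * f x) ≡ c * sumOver xs f
  sumOver-* []       c f = sym (ℤ.*-zeroʳ c)
  sumOver-* (x ∷ xs) c f =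
    trans (cong (_+_ (c * f x)) (sumOver-* xs c f)) (sym (ℤ.*-distribˡ-+ c (f x) (sumOver xs f)))

  sumOver-++ : ∀ (xs ys : List A) (f : A → ℤ) → sumOver (xs ++ ys) f ≡ sumOver xs f + sumOver ys f
  sumOver-++ []       ys f = sym (ℤ.+-identityˡ _)
  sumOver-++ (x ∷ xs) ys f = trans (cong (_+_ (f x)) (sumOver-++ xs ys f)) (sym (ℤ.+-assoc (f x) _ _))

  sumOver-concatMap : ∀ {B : Set} (xs : List B) (g : B → List A) (f : A → ℤ) →
                      sumOver (concatMap g xs) f ≡ sumOver xs (λ x → sumOver (g x) f)
  sumOver-concatMap []       g f = refl
  sumOver-concatMap (x ∷ xs) g f =
    trans (sumOver-++ (g x) (concat (map g xs)) f) (cong (_+_ (sumOver (g x) f)) (sumOver-concatMap xs g f))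

  sumOver-map : ∀ {B : Set} (xs : List B) (g : B → A) (f : A → ℤ) →
                sumOver (map g xs) f ≡ sumOver xs (λ x → f (g x))
  sumOver-map []       g f = refl
  sumOver-map (x ∷ xs) g f = cong (_+_ (f (g x))) (sumOver-map xs g f)

sumOver-linear : ∀ {A : Set} (xs : List A) (x y : ℤ) {f g₁ g₂ : A → ℤ} → LinComb x y f g₁ g₂ →
                 sumOver xs f ≡ x * sumOver xs g₁ + y * sumOver xs g₂
sumOver-linear xs x y {f} {g₁} {g₂} e =
  trans (sumOver-cong xs e) (trans (sumOver-+ xs (λ a → x * g₁ a) (λ a → y * g₂ a))
        (cong₂ _+_ (sumOver-* xs x g₁) (sumOver-* xs y g₂)))

sumOver-tabulate : ∀ {A : Set} n (g : Fin n → A) (f : A → ℤ) → sumOver (tabulate g) f ≡ sum (λ i → f (g i))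
sumOver-tabulate zero    g f = refl
sumOver-tabulate (suc n) g f = cong (_+_ (f (g zero))) (sumOver-tabulate n (λ i → g (suc i)) f)

sumOver-allFin : ∀ n (f : Fin n → ℤ) → sumOver (allFin n) f ≡ sum f
sumOver-allFin n f = sumOver-tabulate n (λ i → i) f

sumOver-blocks : ∀ {A B : Set} n (g : Fin n → B → A) (xs : List B) (f : A → ℤ) →
                 sumOver (concatMap (λ a → map (g a) xs) (allFin n)) f ≡ sum (λ a → sumOver xs (f ∘ g a))
sumOver-blocks n g xs f = begin
  sumOver (concatMap (λ a → map (g a) xs) (allFin n)) f
    ≡⟨ sumOver-concatMap (allFin n) (λ a → map (g a) xs) f ⟩
  sumOver (allFin n) (λ a → sumOver (map (g a) xs) f)
    ≡⟨ sumOver-cong (allFin n) (λ a → sumOver-map xs (g a) f) ⟩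
  sumOver (allFin n) (λ a → sumOver xs (f ∘ g a))
    ≡⟨ sumOver-allFin n (λ a → sumOver xs (f ∘ g a)) ⟩
  sum (λ a → sumOver xs (f ∘ g a)) ∎
  where open ≡-Reasoning

sum-zero : ∀ {n} {f : Fin n → ℤ} → (∀ i → f i ≡ 0ℤ) → sum f ≡ 0ℤ
sum-zero {n} e = trans (sum-cong-≋ e) (sum-replicate-zero n)

sum-const : ∀ {n} (c : ℤ) {f : Fin n → ℤ} → (∀ i → f i ≡ c) → sum f ≡ + n * c
sum-const {zero}  c e = sym (ℤ.*-zeroˡ c)
sum-const {suc n} c e = trans (cong₂ _+_ (e zero) (sum-const c (λ i → e (suc i)))) (succ-* c (+ n))
  where
  succ-* : ∀ (c n : ℤ) → c + n * c ≡ (1ℤ + n) * c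
  succ-* = solve-∀

sum-single : ∀ {n} (a : Fin n) {f : Fin n → ℤ} → (∀ b → b ≢ a → f b ≡ 0ℤ) → sum f ≡ f a
sum-single zero    {f} e = trans (cong (_+_ (f zero)) (sum-zero (λ i → e (suc i) λ ()))) (ℤ.+-identityʳ _)
sum-single (suc a) {f} e =
  trans (cong₂ _+_ (e zero λ ()) (sum-single a λ b b≢a → e (suc b) (b≢a ∘ suc-injective))) (ℤ.+-identityˡ _)

sum-linear : ∀ {n} (x y : ℤ) {f g₁ g₂ : Fin n → ℤ} → LinComb x y f g₁ g₂ →
             sum f ≡ x * sum g₁ + y * sum g₂
sum-linear x y {f} {g₁} {g₂} e =
  trans (sum-cong-≋ e) (trans (∑-distrib-+ (λ i → x * g₁ i) (λ i → y * g₂ i))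
        (sym (cong₂ _+_ (*-distribˡ-sum x g₁) (*-distribˡ-sum y g₂))))

module _ {d h : ℕ} where

  [≡?]-refl : ∀ (u : Vtx d h) → [ u ≡? u ] ≡ 1ℤ
  [≡?]-refl u with u ≟V u
  ... | yes _   = refl
  ... | no u≢u = ⊥-elim (u≢u refl)

  [≡?]-≢ : ∀ {u v : Vtx d h} → u ≢ v → [ u ≡? v ] ≡ 0ℤ
  [≡?]-≢ {u} {v} u≢v with u ≟V v
  ... | yes u≡v = ⊥-elim (u≢v u≡v)
  ... | no _    = refl

module _ {m h : ℕ} where

  [_≡ˢ?_] : Sub m h → Sub m h → ℤ
  [ s ≡ˢ? t ] with s ≟S t
  ... | yes _ = 1ℤ
  ... | no _  = 0ℤ

  [≡ˢ?]-refl : ∀ (s : Sub m h) → [ s ≡ˢ? s ] ≡ 1ℤ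
  [≡ˢ?]-refl s with s ≟S s
  ... | yes _   = refl
  ... | no s≢s = ⊥-elim (s≢s refl)

  [≡ˢ?]-≢ : ∀ {s t : Sub m h} → s ≢ t → [ s ≡ˢ? t ] ≡ 0ℤ
  [≡ˢ?]-≢ {s} {t} s≢t with s ≟S t
  ... | yes s≡t = ⊥-elim (s≢t s≡t)
  ... | no _    = refl

  [_≡ˢ?just_] : Maybe (Sub m h) → Sub m h → ℤ
  [ nothing ≡ˢ?just t ] = 0ℤ
  [ just s  ≡ˢ?just t ] = [ s ≡ˢ? t ]

[≡ˢ?]-below : ∀ {m h} (a : Fin m) (s t : Sub m h) → [ below a s ≡ˢ? below a t ] ≡ [ s ≡ˢ? t ]
[≡ˢ?]-below a s t = by-cases (s ≟S t)
  where
  by-cases : Dec (s ≡ t) → [ below a s ≡ˢ? below a t ] ≡ [ s ≡ˢ? t ]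
  by-cases (yes refl) = trans ([≡ˢ?]-refl (below a s)) (sym ([≡ˢ?]-refl s))
  by-cases (no s≢t)   = trans ([≡ˢ?]-≢ (s≢t ∘ proj₂ ∘ below-inj)) (sym ([≡ˢ?]-≢ s≢t))

isEven : ℕ → Bool
isEven zero    = true
isEven (suc k) = not (isEven k)

not-true : ∀ {b} → not b ≡ true → b ≡ false
not-true {false} _ = refl

not-false : ∀ {b} → not b ≡ false → b ≡ true
not-false {true} _ = refl

module RegularTree (n : ℕ) where

  m : ℕ
  m = suc n

  d : ℕ
  d = suc m

  subSum : ∀ {k} → (Sub m k → ℤ) → ℤ
  subSum {k} = sumOver (allSub m k)

  vtxSum : ∀ {k} → (Vtx d (suc k) → ℤ) → ℤ
  vtxSum {k} = sumOver (allVtx d (suc k))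

  subSum-suc : ∀ {k} (f : Sub m (suc k) → ℤ) → subSum f ≡ f top + sum (λ b → subSum (f ∘ below b))
  subSum-suc {k} f = cong (_+_ (f top)) (sumOver-blocks m below (allSub m k) f)

  vtxSum-split : ∀ {k} (f : Vtx d (suc k) → ℤ) → vtxSum f ≡ f root + sum (λ a → subSum (f ∘ br a))
  vtxSum-split {k} f = cong (_+_ (f root)) (sumOver-blocks d br (allSub m k) f)

  subSum-single : ∀ {k} (s : Sub m k) {f : Sub m k → ℤ} → (∀ t → t ≢ s → f t ≡ 0ℤ) →
                  subSum f ≡ f s
  subSum-single {zero}  top         {f} e = ℤ.+-identityʳ (f top)
  subSum-single {suc k} top         {f} e = begin
    subSum f                                  ≡⟨ subSum-suc f ⟩
    f top + sum (λ b → subSum (f ∘ below b))  ≡⟨ cong (_+_ (f top)) (sum-zero λ b → off-top b) ⟩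
    f top + 0ℤ                                ≡⟨ ℤ.+-identityʳ (f top) ⟩
    f top                                     ∎
    where
    open ≡-Reasoning
    off-top : ∀ b → subSum (f ∘ below b) ≡ 0ℤ
    off-top b = sumOver-zero (allSub m k) λ t → e (below b t) λ ()
  subSum-single {suc k} (below a s) {f} e = begin
    subSum f                                  ≡⟨ subSum-suc f ⟩
    f top + sum (λ b → subSum (f ∘ below b))  ≡⟨ cong₂ _+_ (e top λ ()) (sum-single a other-branch) ⟩
    0ℤ + subSum (f ∘ below a)                 ≡⟨ ℤ.+-identityˡ _ ⟩
    subSum (f ∘ below a)                      ≡⟨ subSum-single s (λ t t≢s → e (below a t) (t≢s ∘ proj₂ ∘ below-inj)) ⟩
    f (below a s)                             ∎
    where
    open ≡-Reasoning
    other-branch : ∀ b → b ≢ a → subSum (f ∘ below b) ≡ 0ℤ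
    other-branch b b≢a = sumOver-zero (allSub m k) λ t → e (below b t) (b≢a ∘ proj₁ ∘ below-inj)

  vtxSum-single : ∀ {k} (v : Vtx d (suc k)) {f : Vtx d (suc k) → ℤ} → (∀ u → u ≢ v → f u ≡ 0ℤ) →
                  vtxSum f ≡ f v
  vtxSum-single {k} root {f} e = begin
    vtxSum f                                ≡⟨ vtxSum-split f ⟩
    f root + sum (λ a → subSum (f ∘ br a))  ≡⟨ cong (_+_ (f root)) (sum-zero λ a → off-root a) ⟩
    f root + 0ℤ                             ≡⟨ ℤ.+-identityʳ (f root) ⟩
    f root                                  ∎
    where
    open ≡-Reasoning
    off-root : ∀ a → subSum (f ∘ br a) ≡ 0ℤ
    off-root a = sumOver-zero (allSub m k) λ t → e (br a t) λ ()
  vtxSum-single {k} (br a s) {f} e = begin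
    vtxSum f                                ≡⟨ vtxSum-split f ⟩
    f root + sum (λ b → subSum (f ∘ br b))  ≡⟨ cong₂ _+_ (e root λ ()) (sum-single a other-branch) ⟩
    0ℤ + subSum (f ∘ br a)                  ≡⟨ ℤ.+-identityˡ _ ⟩
    subSum (f ∘ br a)                       ≡⟨ subSum-single s (λ t t≢s → e (br a t) (t≢s ∘ proj₂ ∘ br-inj)) ⟩
    f (br a s)                              ∎
    where
    open ≡-Reasoning
    other-branch : ∀ b → b ≢ a → subSum (f ∘ br b) ≡ 0ℤ
    other-branch b b≢a = sumOver-zero (allSub m k) λ t → e (br b t) (b≢a ∘ proj₁ ∘ br-inj)

  valueAbove : ∀ {k} → ℤ → (Sub m k → ℤ) → Sub m k → ℤ
  valueAbove P y top         = P
  valueAbove P y (below b t) = valueAbove (y top) (y ∘ below b) t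

  childSumSub : ∀ {k} → (Sub m k → ℤ) → Sub m k → ℤ
  childSumSub {zero}  y top         = 0ℤ
  childSumSub {suc k} y top         = sum (λ b → y (below b top))
  childSumSub         y (below b t) = childSumSub (y ∘ below b) t

  parentValue : ∀ {k} → (Vtx d (suc k) → ℤ) → Vtx d (suc k) → ℤ
  parentValue y root     = 0ℤ
  parentValue y (br a s) = valueAbove (y root) (y ∘ br a) s

  childSum : ∀ {k} → (Vtx d (suc k) → ℤ) → Vtx d (suc k) → ℤ
  childSum y root     = sum (λ a → y (br a top))
  childSum y (br a s) = childSumSub (y ∘ br a) s

  -- The Laplacian Δ c = Σᵢ cᵢ δᵢ

  Δ : ∀ {k} → (Vtx d (suc k) → ℤ) → Vtx d (suc k) → ℤ
  Δ {k} c v = vtxSum (λ i → c i * δ d (suc k) i v)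

  parentOfBelow : ∀ {k} → Fin m → Sub m k → Sub m (suc k)
  parentOfBelow a top         = top
  parentOfBelow a (below c t) = below a (parentOfBelow c t)

  parentSub-below : ∀ {k} (a : Fin m) (t : Sub m k) → parentSub (below a t) ≡ just (parentOfBelow a t)
  parentSub-below a top = refl
  parentSub-below a (below c t) rewrite parentSub-below c t = refl

  liftParent : ∀ {k} → Fin d → Maybe (Sub m k) → Maybe (Vtx d (suc k))
  liftParent a nothing  = just root
  liftParent a (just s) = just (br a s)

  parent-br : ∀ {k} (a : Fin d) (t : Sub m k) → parent (br {d} a t) ≡ liftParent a (parentSub t)
  parent-br a t with parentSub t
  ... | nothing = refl
  ... | just s  = refl

  valueAt : ∀ {k} → (Vtx d (suc k) → ℤ) → Maybe (Vtx d (suc k)) → ℤ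
  valueAt y nothing  = 0ℤ
  valueAt y (just u) = y u

  valueAtSub : ∀ {k} → ℤ → (Sub m k → ℤ) → Maybe (Sub m k) → ℤ
  valueAtSub P g nothing  = P
  valueAtSub P g (just s) = g s

  valueAbove-parentOfBelow : ∀ {k} (g : Sub m (suc k) → ℤ) a (t : Sub m k) →
                             valueAbove (g top) (g ∘ below a) t ≡ g (parentOfBelow a t)
  valueAbove-parentOfBelow g a top         = refl
  valueAbove-parentOfBelow g a (below c t) = valueAbove-parentOfBelow (g ∘ below a) c t

  valueAtSub-parentSub : ∀ {k} P (g : Sub m k → ℤ) s → valueAtSub P g (parentSub s) ≡ valueAbove P g s
  valueAtSub-parentSub P g top = refl
  valueAtSub-parentSub P g (below a t) rewrite parentSub-below a t = sym (valueAbove-parentOfBelow g a t)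

  valueAt-parent : ∀ {k} (y : Vtx d (suc k) → ℤ) v → valueAt y (parent v) ≡ parentValue y v
  valueAt-parent y root = refl
  valueAt-parent y (br a s) rewrite parent-br a s = trans (lift-valueAt (parentSub s)) (valueAtSub-parentSub _ _ s)
    where
    lift-valueAt : ∀ mu → valueAt y (liftParent a mu) ≡ valueAtSub (y root) (y ∘ br a) mu
    lift-valueAt nothing  = refl
    lift-valueAt (just s) = refl

  vtxSum-diagonal : ∀ {k} (y : Vtx d (suc k) → ℤ) v → vtxSum (λ i → y i * [ i ≡? v ]) ≡ y v
  vtxSum-diagonal y v =
    trans (vtxSum-single v λ u u≢v → trans (cong (y u *_) ([≡?]-≢ u≢v)) (ℤ.*-zeroʳ (y u)))
          (trans (cong (y v *_) ([≡?]-refl v)) (ℤ.*-identityʳ (y v)))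

  vtxSum-parent : ∀ {k} (y : Vtx d (suc k) → ℤ) v →
                  vtxSum (λ i → y i * [ parent v ≡?just i ]) ≡ parentValue y v
  vtxSum-parent {k} y v = trans (vtxSum-at (parent v)) (valueAt-parent y v)
    where
    vtxSum-at : ∀ mu → vtxSum (λ i → y i * [ mu ≡?just i ]) ≡ valueAt y mu
    vtxSum-at nothing  = sumOver-zero (allVtx d (suc k)) (λ i → ℤ.*-zeroʳ (y i))
    vtxSum-at (just u) =
      trans (vtxSum-single u λ t t≢u → trans (cong (y t *_) ([≡?]-≢ (t≢u ∘ sym))) (ℤ.*-zeroʳ (y t)))
            (trans (cong (y u *_) ([≡?]-refl u)) (ℤ.*-identityʳ (y u)))

  subSum-diagonal : ∀ {k} (f : Sub m k → ℤ) s → subSum (λ t → f t * [ t ≡ˢ? s ]) ≡ f s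
  subSum-diagonal f s =
    trans (subSum-single s λ t t≢s → trans (cong (f t *_) ([≡ˢ?]-≢ t≢s)) (ℤ.*-zeroʳ (f t)))
          (trans (cong (f s *_) ([≡ˢ?]-refl s)) (ℤ.*-identityʳ (f s)))

  parentOfBelow-top : ∀ {k} a (t : Sub m k) → [ parentOfBelow a t ≡ˢ? top ] ≡ [ t ≡ˢ? top ]
  parentOfBelow-top a top         = refl
  parentOfBelow-top a (below c t) =
    trans ([≡ˢ?]-≢ {s = below a (parentOfBelow c t)} {t = top} λ ())
          (sym ([≡ˢ?]-≢ {s = below c t} {t = top} λ ()))

  parentOfBelow-≢ : ∀ {k} {a b} (t s : Sub m k) → b ≢ a → [ parentOfBelow b t ≡ˢ? below a s ] ≡ 0ℤ
  parentOfBelow-≢ {a = a} top s b≢a = [≡ˢ?]-≢ {s = top} {t = below a s} λ ()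
  parentOfBelow-≢ (below c t) s b≢a = [≡ˢ?]-≢ (b≢a ∘ proj₁ ∘ below-inj)

  parentOfBelow-below : ∀ {k} a (t s : Sub m k) → [ parentOfBelow a t ≡ˢ? below a s ] ≡ [ parentSub t ≡ˢ?just s ]
  parentOfBelow-below a top         s = [≡ˢ?]-≢ {s = top} {t = below a s} λ ()
  parentOfBelow-below a (below c t) s rewrite parentSub-below c t = [≡ˢ?]-below a (parentOfBelow c t) s

  subSum-children : ∀ {k} (g : Sub m k → ℤ) s →
                    subSum (λ t → g t * [ parentSub t ≡ˢ?just s ]) ≡ childSumSub g s
  subSum-children {zero}  g top = trans (ℤ.+-identityʳ _) (ℤ.*-zeroʳ (g top))
  subSum-children {suc k} g s = begin
    subSum (λ t → g t * [ parentSub t ≡ˢ?just s ])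
      ≡⟨ subSum-suc (λ t → g t * [ parentSub t ≡ˢ?just s ]) ⟩
    g top * 0ℤ + sum (λ b → subSum (λ t → g (below b t) * [ parentSub (below b t) ≡ˢ?just s ]))
      ≡⟨ cong₂ _+_ (ℤ.*-zeroʳ (g top)) (sum-cong-≋ λ b → sumOver-cong (allSub m k) λ t →
           cong (λ p → g (below b t) * [ p ≡ˢ?just s ]) (parentSub-below b t)) ⟩
    0ℤ + sum (λ b → subSum (λ t → g (below b t) * [ parentOfBelow b t ≡ˢ? s ]))
      ≡⟨ ℤ.+-identityˡ _ ⟩
    sum (λ b → subSum (λ t → g (below b t) * [ parentOfBelow b t ≡ˢ? s ]))
      ≡⟨ branches s ⟩
    childSumSub g s ∎
    where
    open ≡-Reasoning
    branches : ∀ s → sum (λ b → subSum (λ t → g (below b t) * [ parentOfBelow b t ≡ˢ? s ])) ≡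
                     childSumSub g s
    branches top = sum-cong-≋ λ b → trans
      (sumOver-cong (allSub m k) λ t → cong (g (below b t) *_) (parentOfBelow-top b t))
      (subSum-diagonal (g ∘ below b) top)
    branches (below a s) = trans
      (sum-single a λ b b≢a → sumOver-zero (allSub m k) λ t →
         trans (cong (g (below b t) *_) (parentOfBelow-≢ t s b≢a)) (ℤ.*-zeroʳ (g (below b t))))
      (trans (sumOver-cong (allSub m k) λ t → cong (g (below a t) *_) (parentOfBelow-below a t s))
             (subSum-children (g ∘ below a) s))

  liftParent-root : ∀ {k} a (t : Sub m k) → [ liftParent a (parentSub t) ≡?just root ] ≡ [ t ≡ˢ? top ]
  liftParent-root {k} a top     = [≡?]-refl {d = d} {h = suc k} root
  liftParent-root a (below c t) rewrite parentSub-below c t =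
    trans ([≡?]-≢ {u = br a (parentOfBelow c t)} {v = root} λ ())
          (sym ([≡ˢ?]-≢ {s = below c t} {t = top} λ ()))

  liftParent-≢ : ∀ {k} {a b} (mu : Maybe (Sub m k)) s → b ≢ a → [ liftParent b mu ≡?just br a s ] ≡ 0ℤ
  liftParent-≢ {a = a} nothing  s b≢a = [≡?]-≢ {u = root} {v = br a s} λ ()
  liftParent-≢ (just u) s b≢a = [≡?]-≢ (b≢a ∘ proj₁ ∘ br-inj)

  liftParent-br : ∀ {k} a (mu : Maybe (Sub m k)) s → [ liftParent a mu ≡?just br a s ] ≡ [ mu ≡ˢ?just s ]
  liftParent-br a nothing  s = [≡?]-≢ {u = root} {v = br a s} λ ()
  liftParent-br a (just u) s = by-cases (u ≟S s)
    where
    by-cases : Dec (u ≡ s) → [ br {d} a u ≡? br a s ] ≡ [ u ≡ˢ? s ]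
    by-cases (yes refl) = trans ([≡?]-refl (br {d} a u)) (sym ([≡ˢ?]-refl u))
    by-cases (no u≢s)   = trans ([≡?]-≢ (u≢s ∘ proj₂ ∘ br-inj)) (sym ([≡ˢ?]-≢ u≢s))

  vtxSum-children : ∀ {k} (y : Vtx d (suc k) → ℤ) v →
                    vtxSum (λ i → y i * [ parent i ≡?just v ]) ≡ childSum y v
  vtxSum-children {k} y v = begin
    vtxSum (λ i → y i * [ parent i ≡?just v ])
      ≡⟨ vtxSum-split (λ i → y i * [ parent i ≡?just v ]) ⟩
    y root * 0ℤ + sum (λ a → subSum (λ t → y (br a t) * [ parent (br a t) ≡?just v ]))
      ≡⟨ cong₂ _+_ (ℤ.*-zeroʳ (y root)) (sum-cong-≋ λ a → sumOver-cong (allSub m k) λ t →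
           cong (λ p → y (br a t) * [ p ≡?just v ]) (parent-br a t)) ⟩
    0ℤ + sum (λ a → subSum (λ t → y (br a t) * [ liftParent a (parentSub t) ≡?just v ]))
      ≡⟨ ℤ.+-identityˡ _ ⟩
    sum (λ a → subSum (λ t → y (br a t) * [ liftParent a (parentSub t) ≡?just v ]))
      ≡⟨ branches v ⟩
    childSum y v ∎
    where
    open ≡-Reasoning
    branches : ∀ v → sum (λ a → subSum (λ t → y (br a t) * [ liftParent a (parentSub t) ≡?just v ])) ≡
                     childSum y v
    branches root = sum-cong-≋ λ a → trans
      (sumOver-cong (allSub m k) λ t → cong (y (br a t) *_) (liftParent-root a t))
      (subSum-diagonal (y ∘ br a) top)
    branches (br a s) = trans
      (sum-single a λ b b≢a → sumOver-zero (allSub m k) λ t →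
         trans (cong (y (br b t) *_) (liftParent-≢ (parentSub t) s b≢a)) (ℤ.*-zeroʳ (y (br b t))))
      (trans (sumOver-cong (allSub m k) λ t → cong (y (br a t) *_) (liftParent-br a (parentSub t) s))
             (subSum-children (y ∘ br a) s))

  Δ-pointwise : ∀ {k} (y : Vtx d (suc k) → ℤ) v → Δ y v ≡ + d * y v - childSum y v - parentValue y v
  Δ-pointwise {k} y v = begin
    vtxSum (λ i → y i * δ d (suc k) i v)
      ≡⟨ sumOver-cong xs (λ i → expand (y i) (+ d) [ i ≡? v ] [ parent i ≡?just v ] [ parent v ≡?just i ]) ⟩
    vtxSum (λ i → + d * diagonal i + (-1ℤ * children i + -1ℤ * parents i))
      ≡⟨ sumOver-+ xs (λ i → + d * diagonal i) _ ⟩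
    vtxSum (λ i → + d * diagonal i) + vtxSum (λ i → -1ℤ * children i + -1ℤ * parents i)
      ≡⟨ cong (_+_ (vtxSum (λ i → + d * diagonal i))) (sumOver-+ xs (λ i → -1ℤ * children i) _) ⟩
    vtxSum (λ i → + d * diagonal i) + (vtxSum (λ i → -1ℤ * children i) + vtxSum (λ i → -1ℤ * parents i))
      ≡⟨ cong₂ (λ p q → p + (q + vtxSum (λ i → -1ℤ * parents i)))
               (sumOver-* xs (+ d) diagonal) (sumOver-* xs -1ℤ children) ⟩
    + d * vtxSum diagonal + (-1ℤ * vtxSum children + vtxSum (λ i → -1ℤ * parents i))
      ≡⟨ cong (λ p → + d * vtxSum diagonal + (-1ℤ * vtxSum children + p)) (sumOver-* xs -1ℤ parents) ⟩
    + d * vtxSum diagonal + (-1ℤ * vtxSum children + -1ℤ * vtxSum parents)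
      ≡⟨ cong₂ (λ p q → + d * p + (-1ℤ * q + -1ℤ * vtxSum parents))
               (vtxSum-diagonal y v) (vtxSum-children y v) ⟩
    + d * y v + (-1ℤ * childSum y v + -1ℤ * vtxSum parents)
      ≡⟨ cong (λ p → + d * y v + (-1ℤ * childSum y v + -1ℤ * p)) (vtxSum-parent y v) ⟩
    + d * y v + (-1ℤ * childSum y v + -1ℤ * parentValue y v)
      ≡⟨ collect (+ d) (y v) (childSum y v) (parentValue y v) ⟩
    + d * y v - childSum y v - parentValue y v ∎
    where
    open ≡-Reasoning
    xs = allVtx d (suc k)
    diagonal children parents : Vtx d (suc k) → ℤ
    diagonal i = y i * [ i ≡? v ]
    children i = y i * [ parent i ≡?just v ]
    parents  i = y i * [ parent v ≡?just i ]
    expand : ∀ (y D A B C : ℤ) → y * (D * A - B - C) ≡ D * (y * A) + (-1ℤ * (y * B) + -1ℤ * (y * C))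
    expand = solve-∀
    collect : ∀ (D Y c p : ℤ) → D * Y + (-1ℤ * c + -1ℤ * p) ≡ D * Y - c - p
    collect = solve-∀

  Δ-linear : ∀ {k} (x y : ℤ) {c c₁ c₂ : Vtx d (suc k) → ℤ} → LinComb x y c c₁ c₂ →
             LinComb x y (Δ c) (Δ c₁) (Δ c₂)
  Δ-linear {k} x y e v = sumOver-linear (allVtx d (suc k)) x y λ i →
    trans (cong (_* δ d (suc k) i v) (e i)) (distribute x y _ _ (δ d (suc k) i v))
    where
    distribute : ∀ (x y a b δ : ℤ) → (x * a + y * b) * δ ≡ x * (a * δ) + y * (b * δ)
    distribute = solve-∀

  Δ-zero : ∀ {k} (v : Vtx d (suc k)) → Δ (λ _ → 0ℤ) v ≡ 0ℤ
  Δ-zero {k} v = sumOver-zero (allVtx d (suc k)) λ i → ℤ.*-zeroˡ (δ d (suc k) i v)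

  -- Injectivity of Δ

  repunit : ℕ → ℕ
  repunit zero    = 1
  repunit (suc k) = suc (m ℕ.* repunit k)

  repunit-cancel : ∀ k {x y : ℤ} → + repunit k * x ≡ + repunit k * y → x ≡ y
  repunit-cancel zero    {x} {y} = ℤ.*-cancelˡ-≡ 1ℤ x y
  repunit-cancel (suc k) {x} {y} = ℤ.*-cancelˡ-≡ (+ repunit (suc k)) x y

  repunit-suc : ∀ k → + repunit (suc k) ≡ 1ℤ + + m * + repunit k
  repunit-suc k = pos-suc-* m (repunit k)

  repunit-recurrence : ∀ k t →
                       + d * (+ repunit (suc k) * t) - + m * (+ repunit k * t) ≡ + repunit (suc (suc k)) * t
  repunit-recurrence k t = recurrence (+ m) (+ repunit k) (repunit-suc k) (repunit-suc (suc k))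
    where
    identity : ∀ (M R t : ℤ) → (1ℤ + M) * ((1ℤ + M * R) * t) - M * (R * t) ≡ (1ℤ + M * (1ℤ + M * R)) * t
    identity = solve-∀
    recurrence : ∀ M R₀ {R₁ R₂} → R₁ ≡ 1ℤ + M * R₀ → R₂ ≡ 1ℤ + M * R₁ →
                 (1ℤ + M) * (R₁ * t) - M * (R₀ * t) ≡ R₂ * t
    recurrence M R₀ refl refl = identity M R₀ t

  record Profile {k} (P : ℤ) (y : Sub m k → ℤ) : Set where
    field
      scale    : ℤ
      above    : P ≡ + repunit (suc k) * scale
      atTop    : y top ≡ + repunit k * scale
      vanishes : scale ≡ 0ℤ → ∀ s → y s ≡ 0ℤ

  open Profile

  Profile-scale-unique : ∀ {k} {P} {y y′ : Sub m k → ℤ} (p : Profile P y) (p′ : Profile P y′) →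
                         scale p ≡ scale p′
  Profile-scale-unique {k} p p′ = repunit-cancel (suc k) (trans (sym (above p)) (above p′))

  IsHarmonicSub : ∀ {k} → ℤ → (Sub m k → ℤ) → Set
  IsHarmonicSub P y = ∀ s → + d * y s ≡ valueAbove P y s + childSumSub y s

  profile : ∀ {k} P (y : Sub m k → ℤ) → IsHarmonicSub P y → Profile P y
  profile {zero} P y harmonic = record
    { scale    = y top
    ; above    = begin
        P                    ≡⟨ sym (ℤ.+-identityʳ P) ⟩
        P + 0ℤ               ≡⟨ sym (harmonic top) ⟩
        + d * y top          ≡⟨ cong (λ r → + suc r * y top) (sym (ℕₚ.*-identityʳ m)) ⟩
        + repunit 1 * y top  ∎
    ; atTop    = sym (ℤ.*-identityˡ (y top))
    ; vanishes = λ { t≡0 top → t≡0 }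
    }
    where open ≡-Reasoning
  profile {suc k} P y harmonic = record
    { scale    = t
    ; above    = begin
        P                                                      ≡⟨ a≡b+c⇒b≡a-c (harmonic top) ⟩
        + d * y top - childSumSub y top                        ≡⟨ cong₂ (λ p q → + d * p - q) (above (child zero)) children ⟩
        + d * (+ repunit (suc k) * t) - + m * (+ repunit k * t) ≡⟨ repunit-recurrence k t ⟩
        + repunit (suc (suc k)) * t                            ∎
    ; atTop    = above (child zero)
    ; vanishes = vanish
    }
    where
    open ≡-Reasoning
    child : ∀ b → Profile (y top) (y ∘ below b)
    child b = profile (y top) (y ∘ below b) (harmonic ∘ below b)
    t : ℤ
    t = scale (child zero)
    common : ∀ b → scale (child b) ≡ t
    common b = Profile-scale-unique (child b) (child zero)
    children : childSumSub y top ≡ + m * (+ repunit k * t)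
    children = sum-const (+ repunit k * t) λ b → trans (atTop (child b)) (cong (+ repunit k *_) (common b))
    vanish : t ≡ 0ℤ → ∀ s → y s ≡ 0ℤ
    vanish t≡0 top         = trans (above (child zero)) (trans (cong (+ repunit (suc k) *_) t≡0) (ℤ.*-zeroʳ (+ repunit (suc k))))
    vanish t≡0 (below b s) = vanishes (child b) (trans (common b) t≡0) s

  Δ≡0⇒harmonic : ∀ {k} (z : Vtx d (suc k) → ℤ) v → Δ z v ≡ 0ℤ → + d * z v ≡ parentValue z v + childSum z v
  Δ≡0⇒harmonic z v Δz≡0 = rearrange (trans (sym (Δ-pointwise z v)) Δz≡0)
    where
    rearrange : ∀ {x c p : ℤ} → x - c - p ≡ 0ℤ → x ≡ p + c
    rearrange {x} {c} {p} e = trans (split x c p) (trans (cong (_+ (p + c)) e) (ℤ.+-identityˡ (p + c)))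
      where
      split : ∀ (x c p : ℤ) → x ≡ (x - c - p) + (p + c)
      split = solve-∀

  Δ-injective : ∀ {k} (z : Vtx d (suc k) → ℤ) → (∀ v → Δ z v ≡ 0ℤ) → ∀ v → z v ≡ 0ℤ
  Δ-injective {k} z Δz≡0 = vanish
    where
    harmonic : ∀ v → + d * z v ≡ parentValue z v + childSum z v
    harmonic v = Δ≡0⇒harmonic z v (Δz≡0 v)
    branch : ∀ a → Profile (z root) (z ∘ br a)
    branch a = profile (z root) (z ∘ br a) (harmonic ∘ br a)
    t : ℤ
    t = scale (branch zero)
    common : ∀ a → scale (branch a) ≡ t
    common a = Profile-scale-unique (branch a) (branch zero)
    atRoot : + d * (+ repunit (suc k) * t) ≡ + d * (+ repunit k * t)
    atRoot = begin
      + d * (+ repunit (suc k) * t)  ≡⟨ cong (+ d *_) (above (branch zero)) ⟨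
      + d * z root                   ≡⟨ harmonic root ⟩
      0ℤ + childSum z root           ≡⟨ ℤ.+-identityˡ _ ⟩
      sum (λ a → z (br a top))       ≡⟨ sum-const (+ repunit k * t) tops ⟩
      + d * (+ repunit k * t)        ∎
      where
      open ≡-Reasoning
      tops : ∀ a → z (br a top) ≡ + repunit k * t
      tops a = trans (atTop (branch a)) (cong (+ repunit k *_) (common a))
    t≡0 : t ≡ 0ℤ
    t≡0 = ℤ.*-cancelˡ-≡ (+ suc (n ℕ.* repunit k)) t 0ℤ (begin
      + suc (n ℕ.* repunit k) * t                       ≡⟨ gap (+ n) (+ repunit k) t (pos-suc-* n (repunit k)) (repunit-suc k) ⟩
      + repunit (suc k) * t - + repunit k * t           ≡⟨ cong (_- (+ repunit k * t)) (ℤ.*-cancelˡ-≡ (+ d) _ _ atRoot) ⟩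
      + repunit k * t - + repunit k * t                 ≡⟨ ℤ.+-inverseʳ (+ repunit k * t) ⟩
      0ℤ                                                ≡⟨ ℤ.*-zeroʳ (+ suc (n ℕ.* repunit k)) ⟨
      + suc (n ℕ.* repunit k) * 0ℤ                      ∎)
      where
      open ≡-Reasoning
      identity : ∀ (N R t : ℤ) → (1ℤ + N * R) * t ≡ (1ℤ + (1ℤ + N) * R) * t - R * t
      identity = solve-∀
      gap : ∀ N R t {D R′} → D ≡ 1ℤ + N * R → R′ ≡ 1ℤ + (1ℤ + N) * R → D * t ≡ R′ * t - R * t
      gap N R t refl refl = identity N R t
    vanish : ∀ v → z v ≡ 0ℤ
    vanish root     = trans (above (branch zero)) (trans (cong (+ repunit (suc k) *_) t≡0) (ℤ.*-zeroʳ (+ repunit (suc k))))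
    vanish (br a s) = vanishes (branch a) (trans (common a) t≡0) s

  Δ-eigenvector-in-image : ∀ {k} {x c : Vtx d (suc k) → ℤ} → (∀ v → Δ x v ≡ + d * x v) → (∀ v → x v ≡ Δ c v) →
                           ∀ v → x v ≡ c v * + d
  Δ-eigenvector-in-image {k} {x} {c} Δx≡dx x≡Δc v = move (Δ-injective z Δz≡0 v)
    where
    z : Vtx d (suc k) → ℤ
    z u = x u - + d * c u
    Δz≡0 : ∀ u → Δ z u ≡ 0ℤ
    Δz≡0 u = begin
      Δ z u                              ≡⟨ Δ-linear 1ℤ (- + d) {c₁ = x} {c} (λ w → as-combination (+ d) (x w) (c w)) u ⟩
      1ℤ * Δ x u + - + d * Δ c u         ≡⟨ cong₂ (λ p q → 1ℤ * p + - + d * q) (Δx≡dx u) (sym (x≡Δc u)) ⟩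
      1ℤ * (+ d * x u) + - + d * x u     ≡⟨ cancel (+ d) (x u) ⟩
      0ℤ                                 ∎
      where
      open ≡-Reasoning
      as-combination : ∀ (D e f : ℤ) → e - D * f ≡ 1ℤ * e + - D * f
      as-combination = solve-∀
      cancel : ∀ (D e : ℤ) → 1ℤ * (D * e) + - D * e ≡ 0ℤ
      cancel = solve-∀
    move : ∀ {e f : ℤ} → e - + d * f ≡ 0ℤ → e ≡ f * + d
    move {e} {f} e≡ = trans (regroup (+ d) e f) (trans (cong (_+ f * + d) e≡) (ℤ.+-identityˡ (f * + d)))
      where
      regroup : ∀ (D e f : ℤ) → e ≡ (e - D * f) + f * D
      regroup = solve-∀

  -- Null vectors of the adjacency operator

  -- Child 0 of an off-level vertex absorbs the balance of its parent and siblings.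
  childValue : ∀ {k} → ℤ → (Sub m (suc k) → ℤ) → Fin m → ℤ
  childValue P β zero    = - (P + sum (λ c → β (below (suc c) top)))
  childValue P β (suc c) = β (below (suc c) top)

  -- nullOn τ β: the top is on the support and carries τ;
  -- nullOff P β: the top is off the support and P sits above it.
  mutual
    nullOn : ∀ {k} → ℤ → (Sub m k → ℤ) → Sub m k → ℤ
    nullOn τ β top         = τ
    nullOn τ β (below b t) = nullOff τ (β ∘ below b) t

    nullOff : ∀ {k} → ℤ → (Sub m k → ℤ) → Sub m k → ℤ
    nullOff P β top         = 0ℤ
    nullOff P β (below b t) = nullOn (childValue P β b) (β ∘ below b) t

  IsNullSub : ∀ {k} → ℤ → (Sub m k → ℤ) → Set
  IsNullSub P y = ∀ s → valueAbove P y s + childSumSub y s ≡ 0ℤ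

  mutual
    nullOn-null : ∀ {k} → isEven k ≡ true → ∀ τ β → IsNullSub {k} 0ℤ (nullOn τ β)
    nullOn-null {zero}  even τ β top         = refl
    nullOn-null {suc k} even τ β top         =
      trans (ℤ.+-identityˡ _) (sum-zero {f = λ b → nullOn τ β (below b top)} λ b → refl)
    nullOn-null {suc k} even τ β (below b s) = nullOff-null (not-true even) τ (β ∘ below b) s

    nullOff-null : ∀ {k} → isEven k ≡ false → ∀ P β → IsNullSub {k} P (nullOff P β)
    nullOff-null {zero}  ()
    nullOff-null {suc k} odd P β top         = cancels P (sum (λ c → β (below (suc c) top)))
      where
      cancels : ∀ (P S : ℤ) → P + (- (P + S) + S) ≡ 0ℤ
      cancels = solve-∀
    nullOff-null {suc k} odd P β (below b s) = nullOn-null (not-false odd) (childValue P β b) (β ∘ below b) s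

  rootChildValue : ∀ {k} → (Vtx d (suc k) → ℤ) → Fin d → ℤ
  rootChildValue β zero    = - sum (λ c → β (br (suc c) top))
  rootChildValue β (suc c) = β (br (suc c) top)

  -- The Boolean is true when the root lies off the support, i.e. the leaves are at odd depth.
  nullVector′ : Bool → ∀ k → (Vtx d (suc k) → ℤ) → Vtx d (suc k) → ℤ
  nullVector′ true  k β root     = 0ℤ
  nullVector′ true  k β (br a s) = nullOn (rootChildValue β a) (β ∘ br a) s
  nullVector′ false k β root     = β root
  nullVector′ false k β (br a s) = nullOff (β root) (β ∘ br a) s

  nullVector : ∀ k → (Vtx d (suc k) → ℤ) → Vtx d (suc k) → ℤ
  nullVector k = nullVector′ (isEven k) k

  nullVector′-null : ∀ k {b} → isEven k ≡ b → ∀ β v →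
                     parentValue (nullVector′ b k β) v + childSum (nullVector′ b k β) v ≡ 0ℤ
  nullVector′-null k {true}  even β root     = cancels (sum (λ c → β (br (suc c) top)))
    where
    cancels : ∀ (S : ℤ) → 0ℤ + (- S + S) ≡ 0ℤ
    cancels = solve-∀
  nullVector′-null k {true}  even β (br a s) = nullOn-null even (rootChildValue β a) (β ∘ br a) s
  nullVector′-null k {false} odd  β root     =
    trans (ℤ.+-identityˡ _) (sum-zero {f = λ a → nullOff (β root) (β ∘ br a) top} λ a → refl)
  nullVector′-null k {false} odd  β (br a s) = nullOff-null odd (β root) (β ∘ br a) s

  Δ-nullVector : ∀ k β v → Δ (nullVector k β) v ≡ + d * nullVector k β v
  Δ-nullVector k β v = begin
    Δ y v                                        ≡⟨ Δ-pointwise y v ⟩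
    + d * y v - childSum y v - parentValue y v   ≡⟨ drop (nullVector′-null k refl β v) ⟩
    + d * y v                                    ∎
    where
    open ≡-Reasoning
    y = nullVector k β
    drop : ∀ {X C P : ℤ} → P + C ≡ 0ℤ → X - C - P ≡ X
    drop {X} {C} {P} e = trans (regroup X C P) (trans (cong (_-_ X) e) (ℤ.+-identityʳ X))
      where
      regroup : ∀ (X C P : ℤ) → X - C - P ≡ X - (P + C)
      regroup = solve-∀

  childValue-linear : ∀ {k} (x y : ℤ) {P P₁ P₂ : ℤ} {β β₁ β₂ : Sub m (suc k) → ℤ} →
                      P ≡ x * P₁ + y * P₂ → LinComb x y β β₁ β₂ →
                      LinComb x y (childValue P β) (childValue P₁ β₁) (childValue P₂ β₂)
  childValue-linear x y {P} {P₁} {P₂} refl e zero =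
    trans (cong (λ S → - (x * P₁ + y * P₂ + S)) (sum-linear x y (λ c → e (below (suc c) top))))
          (negate x y P₁ P₂ _ _)
    where
    negate : ∀ (x y P₁ P₂ S₁ S₂ : ℤ) →
             - ((x * P₁ + y * P₂) + (x * S₁ + y * S₂)) ≡ x * (- (P₁ + S₁)) + y * (- (P₂ + S₂))
    negate = solve-∀
  childValue-linear x y _ e (suc c) = e (below (suc c) top)

  mutual
    nullOn-linear : ∀ {k} (x y : ℤ) {τ τ₁ τ₂ : ℤ} {β β₁ β₂ : Sub m k → ℤ} →
                    τ ≡ x * τ₁ + y * τ₂ → LinComb x y β β₁ β₂ →
                    LinComb x y (nullOn τ β) (nullOn τ₁ β₁) (nullOn τ₂ β₂)
    nullOn-linear x y eτ eβ top         = eτ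
    nullOn-linear x y eτ eβ (below b t) = nullOff-linear x y eτ (eβ ∘ below b) t

    nullOff-linear : ∀ {k} (x y : ℤ) {P P₁ P₂ : ℤ} {β β₁ β₂ : Sub m k → ℤ} →
                     P ≡ x * P₁ + y * P₂ → LinComb x y β β₁ β₂ →
                     LinComb x y (nullOff P β) (nullOff P₁ β₁) (nullOff P₂ β₂)
    nullOff-linear x y eP eβ top         = zero-lincomb x y
    nullOff-linear x y eP eβ (below b t) = nullOn-linear x y (childValue-linear x y eP eβ b) (eβ ∘ below b) t

  rootChildValue-linear : ∀ {k} (x y : ℤ) {β β₁ β₂ : Vtx d (suc k) → ℤ} → LinComb x y β β₁ β₂ →
                          LinComb x y (rootChildValue β) (rootChildValue β₁) (rootChildValue β₂)
  rootChildValue-linear x y e zero =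
    trans (cong -_ (sum-linear x y (λ c → e (br (suc c) top)))) (negate x y _ _)
    where
    negate : ∀ (x y S₁ S₂ : ℤ) → - (x * S₁ + y * S₂) ≡ x * (- S₁) + y * (- S₂)
    negate = solve-∀
  rootChildValue-linear x y e (suc c) = e (br (suc c) top)

  nullVector-linear : ∀ k (x y : ℤ) {β β₁ β₂ : Vtx d (suc k) → ℤ} → LinComb x y β β₁ β₂ →
                      LinComb x y (nullVector k β) (nullVector k β₁) (nullVector k β₂)
  nullVector-linear k x y e = linear (isEven k)
    where
    linear : ∀ b → LinComb x y (nullVector′ b k _) (nullVector′ b k _) (nullVector′ b k _)
    linear true  root     = zero-lincomb x y
    linear true  (br a s) = nullOn-linear x y (rootChildValue-linear x y e a) (e ∘ br a) s
    linear false root     = e root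
    linear false (br a s) = nullOff-linear x y (e root) (e ∘ br a) s

  subNull : Bool → ∀ {k} → ℤ → (Sub m k → ℤ) → Sub m k → ℤ
  subNull true  P β = nullOn (β top) β
  subNull false P β = nullOff P β

  Free : Bool → ∀ {k} → Sub m k → Set
  Free b x = ∀ P β → subNull b P β x ≡ β x

  FreeAt : ∀ k → Sub m k → Set
  FreeAt k = Free (isEven k)

  Free-top : ∀ {b k} → Free b {k} top → b ≡ true
  Free-top {true}  free = refl
  Free-top {false} free with free 0ℤ (λ _ → 1ℤ)
  ... | ()

  FreeAt-top : ∀ {k} → isEven k ≡ true → FreeAt k top
  FreeAt-top even rewrite even = λ P β → refl

  nullOn-below : ∀ {k} {c : Fin m} {x : Sub m k} → Free true (below c x) →
                 ∀ τ β → nullOn τ β (below c x) ≡ β (below c x)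
  nullOn-below free τ β = free 0ℤ withTop
    where
    withTop : Sub m _ → ℤ
    withTop top         = τ
    withTop (below e u) = β (below e u)

  Free-below-suc : ∀ {b k} {x : Sub m k} {c : Fin n} → Free b x → Free (not b) (below (suc c) x)
  Free-below-suc {true}  {c = c} free P β = free P (β ∘ below (suc c))
  Free-below-suc {false} {c = c} free P β = free (β top) (β ∘ below (suc c))

  Free-below-zero : ∀ {b k} {x : Sub m k} {c : Fin m} → Free b (below c x) → Free (not b) (below zero (below c x))
  Free-below-zero {true}  free P β = nullOn-below free (childValue P β zero) (β ∘ below zero)
  Free-below-zero {false} free P β = free (β top) (β ∘ below zero)

  Word : ℕ → Set
  Word = Fin m Tuple.^_

  Slot : ℕ → Set
  Slot j = Sub m (suc j) ⊎ Sub m j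

  FreeSlot : ∀ {j} → Slot j → Set
  FreeSlot {j} (inj₁ x) = FreeAt (suc j) x
  FreeSlot {j} (inj₂ y) = FreeAt j y

  -- step hangs a position below child c of a new top.  The one clash, child 0 of a free top
  -- (which absorbs the balance), is traded for the new top of the other component.
  step : ∀ {j} → Fin m → Slot j → Slot (suc j)
  step zero    (inj₁ top)         = inj₂ top
  step zero    (inj₁ (below b x)) = inj₁ (below zero (below b x))
  step (suc c) (inj₁ x)           = inj₁ (below (suc c) x)
  step zero    (inj₂ top)         = inj₁ top
  step zero    (inj₂ (below b y)) = inj₂ (below zero (below b y))
  step (suc c) (inj₂ y)           = inj₂ (below (suc c) y)

  unstep : ∀ {j} → Slot (suc j) → Fin m × Slot j
  unstep (inj₁ top)         = zero , inj₂ top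
  unstep (inj₁ (below c x)) = c , inj₁ x
  unstep (inj₂ top)         = zero , inj₁ top
  unstep (inj₂ (below c y)) = c , inj₂ y

  unstep-step : ∀ {j} c (z : Slot j) → unstep (step c z) ≡ (c , z)
  unstep-step zero    (inj₁ top)         = refl
  unstep-step zero    (inj₁ (below b x)) = refl
  unstep-step (suc c) (inj₁ x)           = refl
  unstep-step zero    (inj₂ top)         = refl
  unstep-step zero    (inj₂ (below b y)) = refl
  unstep-step (suc c) (inj₂ y)           = refl

  step-free : ∀ {j} c (z : Slot j) → FreeSlot z → FreeSlot (step c z)
  step-free {j} zero    (inj₁ top)         free = free
  step-free {j} zero    (inj₁ (below b x)) free = Free-below-zero {isEven (suc j)} free
  step-free {j} (suc c) (inj₁ x)           free = Free-below-suc {isEven (suc j)} free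
  step-free {j} zero    (inj₂ top)         free = FreeAt-top {suc (suc j)} (cong (not ∘ not) (Free-top free))
  step-free {j} zero    (inj₂ (below b y)) free = Free-below-zero {isEven j} free
  step-free {j} (suc c) (inj₂ y)           free = Free-below-suc {isEven j} free

  subCode : ∀ j → Word (suc j) → Slot j
  subCode zero    zero    = inj₂ top
  subCode zero    (suc c) = inj₁ (below (suc c) top)
  subCode (suc j) (c , w) = step c (subCode j w)

  subDecode : ∀ j → Slot j → Word (suc j)
  subDecode zero    (inj₁ (below c _)) = c
  subDecode zero    _                  = zero
  subDecode (suc j) z                  = proj₁ (unstep z) , subDecode j (proj₂ (unstep z))

  subDecode-subCode : ∀ j w → subDecode j (subCode j w) ≡ w
  subDecode-subCode zero    zero    = refl
  subDecode-subCode zero    (suc c) = refl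
  subDecode-subCode (suc j) (c , w) rewrite unstep-step c (subCode j w) = cong (c ,_) (subDecode-subCode j w)

  subCode-free : ∀ j w → FreeSlot (subCode j w)
  subCode-free zero    zero    = λ P β → refl
  subCode-free zero    (suc c) = Free-below-suc {true} λ P β → refl
  subCode-free (suc j) (c , w) = step-free c (subCode j w) (subCode-free j w)

  -- As for step, with the subtree of the root's child 0 as second component and the root
  -- replacing the clash.
  vtxOf : ∀ {j} → Fin m → Slot j → Vtx d (suc (suc j))
  vtxOf c       (inj₁ x)           = br (suc c) x
  vtxOf zero    (inj₂ top)         = root
  vtxOf zero    (inj₂ (below b y)) = br zero (below zero (below b y))
  vtxOf (suc c) (inj₂ y)           = br zero (below (suc c) y)

  unvtx : ∀ {j} → Vtx d (suc (suc j)) → Fin m × Slot j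
  unvtx root                  = zero , inj₂ top
  unvtx (br zero top)         = zero , inj₂ top
  unvtx (br zero (below c y)) = c , inj₂ y
  unvtx (br (suc c) x)        = c , inj₁ x

  unvtx-vtxOf : ∀ {j} c (z : Slot j) → unvtx (vtxOf c z) ≡ (c , z)
  unvtx-vtxOf c       (inj₁ x)           = refl
  unvtx-vtxOf zero    (inj₂ top)         = refl
  unvtx-vtxOf zero    (inj₂ (below b y)) = refl
  unvtx-vtxOf (suc c) (inj₂ y)           = refl

  vtxCode : ∀ k → Word (suc k) → Vtx d (suc k)
  vtxCode zero    c       = br (suc c) top
  vtxCode (suc j) (c , w) = vtxOf c (subCode j w)

  vtxDecode : ∀ k → Vtx d (suc k) → Word (suc k)
  vtxDecode zero    (br (suc c) _) = c
  vtxDecode zero    _              = zero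
  vtxDecode (suc j) v              = proj₁ (unvtx v) , subDecode j (proj₂ (unvtx v))

  vtxDecode-vtxCode : ∀ k w → vtxDecode k (vtxCode k w) ≡ w
  vtxDecode-vtxCode zero    c       = refl
  vtxDecode-vtxCode (suc j) (c , w) rewrite unvtx-vtxOf c (subCode j w) = cong (c ,_) (subDecode-subCode j w)

  nullVector′-br-suc : ∀ {b k} {c : Fin m} {x : Sub m k} → Free b x →
                       ∀ β → nullVector′ b k β (br (suc c) x) ≡ β (br (suc c) x)
  nullVector′-br-suc {true}  {c = c} free β = free 0ℤ (β ∘ br (suc c))
  nullVector′-br-suc {false} {c = c} free β = free (β root) (β ∘ br (suc c))

  nullVector′-br-below : ∀ {b k} {c : Fin m} {x : Sub m k} → Free b (below c x) →
                         ∀ β → nullVector′ b (suc k) β (br zero (below c x)) ≡ β (br zero (below c x))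
  nullVector′-br-below {true}  free β = nullOn-below free (rootChildValue β zero) (β ∘ br zero)
  nullVector′-br-below {false} free β = free (β root) (β ∘ br zero)

  nullVector-vtxOf : ∀ {j} c (z : Slot j) → FreeSlot z → ∀ β → nullVector (suc j) β (vtxOf c z) ≡ β (vtxOf c z)
  nullVector-vtxOf {j} c       (inj₁ x)           free = nullVector′-br-suc {isEven (suc j)} free
  nullVector-vtxOf {j} zero    (inj₂ top)         free β rewrite Free-top {isEven j} free = refl
  nullVector-vtxOf {j} zero    (inj₂ (below b y)) free =
    nullVector′-br-below {isEven (suc j)} (Free-below-zero {isEven j} free)
  nullVector-vtxOf {j} (suc c) (inj₂ y)           free =
    nullVector′-br-below {isEven (suc j)} (Free-below-suc {isEven j} free)

  nullVector-vtxCode : ∀ k w β → nullVector k β (vtxCode k w) ≡ β (vtxCode k w)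
  nullVector-vtxCode zero    c       β = refl
  nullVector-vtxCode (suc j) (c , w) β = nullVector-vtxOf c (subCode j w) (subCode-free j w) β

  -- The embedding

  module Embedding (k : ℕ) where
    open Inverse (Tuple.Fin[m^n]↔Fin[m]^n m (suc k)) using (to; from; strictlyInverseʳ)

    N : ℕ
    N = m ^ suc k

    index : Fin N → Vtx d (suc k)
    index i = vtxCode k (to i)

    coordinate : Vtx d (suc k) → Fin N
    coordinate v = from (vtxDecode k v)

    coordinate-index : ∀ i → coordinate (index i) ≡ i
    coordinate-index i = trans (cong from (vtxDecode-vtxCode k (to i))) (strictlyInverseʳ i)

    embed : (Fin N → ℤ) → Vtx d (suc k) → ℤ
    embed a = nullVector k (a ∘ coordinate)

    embed-index : ∀ a i → embed a (index i) ≡ a i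
    embed-index a i = trans (nullVector-vtxCode k (to i) (a ∘ coordinate)) (cong a (coordinate-index i))

    Δ-embed : ∀ a v → Δ (embed a) v ≡ + d * embed a v
    Δ-embed a = Δ-nullVector k (a ∘ coordinate)

    embed-linear : ∀ x y {a a₁ a₂ : Fin N → ℤ} → LinComb x y a a₁ a₂ →
                   LinComb x y (embed a) (embed a₁) (embed a₂)
    embed-linear x y e = nullVector-linear k x y (e ∘ coordinate)

    hom : ∀ a b → EqG d (suc k) (embed (a +V b)) (embed a +V embed b)
    hom a b = (λ _ → 0ℤ) , λ v → begin
      embed (a +V b) v - (embed a v + embed b v)
        ≡⟨ cong (_- (embed a v + embed b v)) (embed-linear 1ℤ 1ℤ {a +V b} {a} {b} (λ i → units (a i) (b i)) v) ⟩
      1ℤ * embed a v + 1ℤ * embed b v - (embed a v + embed b v)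
        ≡⟨ cancel (embed a v) (embed b v) ⟩
      0ℤ
        ≡⟨ Δ-zero v ⟨
      Δ (λ _ → 0ℤ) v ∎
      where
      open ≡-Reasoning
      units : ∀ (a b : ℤ) → a + b ≡ 1ℤ * a + 1ℤ * b
      units = solve-∀
      cancel : ∀ (a b : ℤ) → 1ℤ * a + 1ℤ * b - (a + b) ≡ 0ℤ
      cancel = solve-∀

    wd : ∀ a b → EqZd d N a b → EqG d (suc k) (embed a) (embed b)
    wd a b a≡b = embed q , λ v → begin
      embed a v - embed b v
        ≡⟨ cong (_- embed b v) (embed-linear 1ℤ (+ d) {a} {b} {q} (λ i → shift (proj₂ (a≡b i))) v) ⟩
      1ℤ * embed b v + + d * embed q v - embed b v
        ≡⟨ cancel (embed b v) (+ d * embed q v) ⟩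
      + d * embed q v
        ≡⟨ Δ-embed q v ⟨
      Δ (embed q) v ∎
      where
      open ≡-Reasoning
      q : Fin N → ℤ
      q i = proj₁ (a≡b i)
      shift : ∀ {a b q : ℤ} → a - b ≡ q * + d → a ≡ 1ℤ * b + + d * q
      shift {a} {b} {q} e = trans (move-left a b) (trans (cong (_+_ b) e) (commute b q (+ d)))
        where
        move-left : ∀ (a b : ℤ) → a ≡ b + (a - b)
        move-left = solve-∀
        commute : ∀ (b q D : ℤ) → b + q * D ≡ 1ℤ * b + D * q
        commute = solve-∀
      cancel : ∀ (b e : ℤ) → 1ℤ * b + e - b ≡ e
      cancel = solve-∀

    Δ-difference : ∀ a b v → Δ (λ u → embed a u - embed b u) v ≡ + d * (embed a v - embed b v)
    Δ-difference a b v = begin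
      Δ (λ u → embed a u - embed b u) v
        ≡⟨ Δ-linear 1ℤ -1ℤ {c₁ = embed a} {embed b} (λ u → as-combination (embed a u) (embed b u)) v ⟩
      1ℤ * Δ (embed a) v + -1ℤ * Δ (embed b) v
        ≡⟨ cong₂ (λ p q → 1ℤ * p + -1ℤ * q) (Δ-embed a v) (Δ-embed b v) ⟩
      1ℤ * (+ d * embed a v) + -1ℤ * (+ d * embed b v)
        ≡⟨ factor (+ d) (embed a v) (embed b v) ⟩
      + d * (embed a v - embed b v) ∎
      where
      open ≡-Reasoning
      as-combination : ∀ (a b : ℤ) → a - b ≡ 1ℤ * a + -1ℤ * b
      as-combination = solve-∀
      factor : ∀ (D a b : ℤ) → 1ℤ * (D * a) + -1ℤ * (D * b) ≡ D * (a - b)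
      factor = solve-∀

    inj : ∀ a b → EqG d (suc k) (embed a) (embed b) → EqZd d N a b
    inj a b (c , diff≡Δc) i = c (index i) , (begin
      a i - b i                              ≡⟨ cong₂ _-_ (embed-index a i) (embed-index b i) ⟨
      embed a (index i) - embed b (index i)  ≡⟨ Δ-eigenvector-in-image {c = c} (Δ-difference a b) diff≡Δc (index i) ⟩
      c (index i) * + d                      ∎)
      where open ≡-Reasoning

    embedding : ZdEmbedding N d (suc k)
    embedding = record { f = embed ; wd = wd ; hom = hom ; inj = inj }

lemma6p6 : (d h : ℕ) → 3 ≤ d → 1 ≤ h → ZdEmbedding ((d ∸ 1) ^ h) d h
lemma6p6 (suc (suc (suc n))) (suc k) (s≤s (s≤s (s≤s _))) (s≤s _) = RegularTree.Embedding.embedding (suc n) k
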